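{- Let $G$ be a finite simple graph of maximum degree $\Delta$. In Maker-Maker Incidence, $Ls(G)\leq\frac{\Delta}{2}$.
   Context: Maker-Maker Incidence on a graph $G$: Left and Right alternately claim a not yet claimed vertex until all vertices are claimed; the final value is the number of edges with both endpoints claimed by Left minus the number of edges with both endpoints claimed by Right; Left maximizes and Right minimizes it. $Ls(G)$ is the final value under optimal play when Left moves first. -}

module Defs where

open import Data.Nat as ℕ using (ℕ; zero; suc)
open import Data.Integer as ℤ using (ℤ; +_; _-_)
open import Data.Fin using (Fin; _<?_)
open import Data.Bool using (Bool; true; false; _∧_; if_then_else_)
open import Data.Vec as V using (Vec; []; _∷_; allFin)
open import Data.List as L using (List; []; _∷_)
open import Data.Product using (_×_; _,_)
open import Relation.Nullary.Decidable using (⌊_⌋)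
open import Relation.Binary.PropositionalEquality using (_≡_)

record SimpleGraph (n : ℕ) : Set where
  field
    adj    : Fin n → Fin n → Bool
    sym    : ∀ u v → adj u v ≡ adj v u
    irrefl : ∀ v → adj v v ≡ false
open SimpleGraph public

degree : ∀ {n} → SimpleGraph n → Fin n → ℕ
degree {n} G v = V.count (λ u → Data.Bool._≟_ (adj G v u) true) (allFin n)
  where import Data.Bool

maxDegree : ∀ {n} → SimpleGraph n → ℕ
maxDegree {n} G = V.foldr _ (λ v m → degree G v ℕ.⊔ m) 0 (allFin n)

data Player : Set where
  Left Right : Player

data Owner : Set where
  unclaimed : Owner
  owned     : Player → Owner

State : ℕ → Set
State n = Fin n → Owner

claim : ∀ {n} → Fin n → Player → State n → State n
claim {n} v p s u = if ⌊ u Data.Fin.≟ v ⌋ then owned p else s u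
  where import Data.Fin

edgeVal : ∀ {n} → SimpleGraph n → State n → Fin n → Fin n → ℤ
edgeVal G s u v with adj G u v | s u | s v
... | true | owned Left  | owned Left  = + 1
... | true | owned Right | owned Right = ℤ.-[1+ 0 ]
... | _    | _           | _           = + 0

-- final value: (#edges with both ends Left) − (#edges with both ends Right),
-- each edge counted once as an unordered pair {u,v} with u < v
score : ∀ {n} → SimpleGraph n → State n → ℤ
score {n} G s =
  V.foldr _ (λ u acc →
    V.foldr _ (λ v acc' → (if ⌊ u <? v ⌋ then edgeVal G s u v else + 0) ℤ.+ acc') acc (allFin n))
    (+ 0) (allFin n)

select : ∀ {A : Set} {k} → Vec A (suc k) → List (A × Vec A k)
select {k = zero}  (x ∷ []) = (x , []) ∷ []
select {k = suc k} (x ∷ xs) = (x , xs) ∷ L.map (λ { (y , ys) → (y , x ∷ ys) }) (select xs)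

-- max / min of a list of integers (only ever applied to nonempty lists)
maxList : List ℤ → ℤ
maxList []       = + 0
maxList (x ∷ []) = x
maxList (x ∷ xs@(_ ∷ _)) = x ℤ.⊔ maxList xs

minList : List ℤ → ℤ
minList []       = + 0
minList (x ∷ []) = x
minList (x ∷ xs@(_ ∷ _)) = x ℤ.⊓ minList xs

other : Player → Player
other Left  = Right
other Right = Left

play : ∀ {n} → SimpleGraph n → (k : ℕ) → Vec (Fin n) k → Player → State n → ℤ
play G zero    []   p s = score G s
play G (suc k) rest Left  s =
  maxList (L.map (λ { (v , rest') → play G k rest' Right (claim v Left s) }) (select rest))
play G (suc k) rest Right s =
  minList (L.map (λ { (v , rest') → play G k rest' Left (claim v Right s) }) (select rest))

Ls : ∀ {n} → SimpleGraph n → ℤ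
Ls {n} G = play G n (allFin n) Left (λ _ → unclaimed)

-- Give every claimed vertex its degree, with sign +1 if Left owns it and −1 if Right does.
-- Once all vertices are claimed this signed degree sum is exactly twice the final value: an
-- edge inside Left contributes 1 + 1, an edge inside Right −1 − 1, a mixed edge 1 − 1.
-- Let Right always claim a remaining vertex of maximum degree. A Left move raises the sum by
-- at most the largest remaining degree, and the Right move before it lowered the sum by at
-- least that much. Hence, by induction on the number of free vertices, twice the value is at
-- most the signed sum when Right is to move, and at most the signed sum plus the largest
-- remaining degree when Left is to move; on the empty board this bound is Δ.
module Submission where

open import Defs
open import Data.Nat using (ℕ)
open import Data.Integer using (_≤_; _*_; +_)

open import Data.Bool using (Bool; true; false; if_then_else_)
open import Data.Empty using (⊥-elim)
open import Data.Fin using (Fin; zero; suc; _<?_)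
import Data.Fin.Properties as FinP
open import Data.Integer using (ℤ; 0ℤ; 1ℤ; -1ℤ; _+_; +≤+)
import Data.Integer.Properties as ℤP
open import Data.Integer.Tactic.RingSolver using (solve-∀)
open import Data.List as List using (List; []; _∷_)
open import Data.List.Membership.Propositional using () renaming (_∈_ to _∈ₗ_)
open import Data.List.Membership.Propositional.Properties using (∈-map⁺; ∈-map⁻)
open import Data.List.Relation.Unary.Any using (here; there)
open import Data.Nat as ℕ using (zero; suc)
import Data.Nat.Properties as ℕP
open import Data.Product using (_×_; _,_; ∃₂)
open import Data.Sum using (inj₁; inj₂)
open import Data.Vec as Vec using (Vec; []; _∷_; allFin; tabulate)
open import Data.Vec.Membership.Propositional using (_∈_)
open import Data.Vec.Membership.Propositional.Properties using (∈-allFin⁺)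
open import Data.Vec.Relation.Unary.All as All using (All; []; _∷_)
open import Data.Vec.Relation.Unary.AllPairs as AllPairs using (_∷_)
open import Data.Vec.Relation.Unary.Any using (here; there)
open import Data.Vec.Relation.Unary.Unique.Propositional using (Unique)
import Data.Vec.Relation.Unary.Unique.Propositional.Properties as Unique
open import Function using (_∘_; id; flip)
import Relation.Binary.PropositionalEquality as ≡
open ≡ using (_≡_; _≢_; refl; trans; cong; cong₂; module ≡-Reasoning)
open import Relation.Nullary using (¬_; yes; no; does)
open import Relation.Nullary.Decidable using (⌊_⌋)
open import Relation.Unary using (Decidable)

open import Algebra.Properties.CommutativeSemigroup ℤP.+-commutativeSemigroup using (x∙yz≈y∙xz)
open import Algebra.Properties.Semiring.Sum ℤP.+-*-semiring
  using (sum-syntax; sum-cong-≗; sum-replicate-zero; ∑-distrib-+; ∑-comm; *-distribˡ-sum)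

foldr-tabulate : ∀ {A : Set} {m} (_⊕_ : ∀ {k : ℕ} → A → ℤ → ℤ) (f : A → ℤ) →
                 (∀ {k} x a → _⊕_ {k} x a ≡ f x + a) → (g : Fin m → A) (a : ℤ) →
                 Vec.foldr (λ _ → ℤ) (λ {k} → _⊕_ {k}) a (tabulate g) ≡ ∑[ i < m ] f (g i) + a
foldr-tabulate {m = zero}  _⊕_ f ⊕≡ g a = ≡.sym (ℤP.+-identityˡ a)
foldr-tabulate {m = suc m} _⊕_ f ⊕≡ g a =
  trans (⊕≡ (g zero) _)
        (trans (cong (_+_ (f (g zero))) (foldr-tabulate (λ {k} → _⊕_ {k}) f ⊕≡ (g ∘ suc) a))
               (≡.sym (ℤP.+-assoc (f (g zero)) _ a)))

indicator : Bool → ℤ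
indicator b = if b then 1ℤ else 0ℤ

count-tabulate : ∀ {A : Set} {P : A → Set} (P? : Decidable P) {m} (g : Fin m → A) →
                 + Vec.count P? (tabulate g) ≡ ∑[ i < m ] indicator (does (P? (g i)))
count-tabulate P? {zero}  g = refl
count-tabulate P? {suc m} g with does (P? (g zero))
... | true  = cong (_+_ 1ℤ) (count-tabulate P? (g ∘ suc))
... | false = trans (count-tabulate P? (g ∘ suc)) (≡.sym (ℤP.+-identityˡ _))

∑-update : ∀ {n} (f g : Fin n → ℤ) i → (∀ j → j ≢ i → f j ≡ g j) →
           f i + ∑[ j < n ] g j ≡ g i + ∑[ j < n ] f j
∑-update f g zero agree =
  trans (cong (λ x → f zero + (g zero + x)) (sum-cong-≗ (λ j → ≡.sym (agree (suc j) λ ()))))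
        (x∙yz≈y∙xz (f zero) (g zero) _)
∑-update {suc n} f g (suc i) agree = begin
  f (suc i) + (g zero + ∑[ j < n ] g (suc j))
    ≡⟨ cong (λ x → f (suc i) + (x + _)) (≡.sym (agree zero λ ())) ⟩
  f (suc i) + (f zero + ∑[ j < n ] g (suc j))
    ≡⟨ x∙yz≈y∙xz (f (suc i)) (f zero) _ ⟩
  f zero + (f (suc i) + ∑[ j < n ] g (suc j))
    ≡⟨ cong (_+_ (f zero)) (∑-update (f ∘ suc) (g ∘ suc) i agree-suc) ⟩
  f zero + (g (suc i) + ∑[ j < n ] f (suc j))
    ≡⟨ x∙yz≈y∙xz (f zero) (g (suc i)) _ ⟩
  g (suc i) + (f zero + ∑[ j < n ] f (suc j)) ∎
  where
  open ≡-Reasoning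
  agree-suc : ∀ j → j ≢ i → f (suc j) ≡ g (suc j)
  agree-suc j j≢i = agree (suc j) (j≢i ∘ FinP.suc-injective)

upper : ∀ {n} → (Fin n → Fin n → ℤ) → Fin n → Fin n → ℤ
upper h i j = if ⌊ i <? j ⌋ then h i j else 0ℤ

upper-+ : ∀ {n} (h h′ : Fin n → Fin n → ℤ) i j →
          upper (λ i j → h i j + h′ i j) i j ≡ upper h i j + upper h′ i j
upper-+ h h′ i j with ⌊ i <? j ⌋
... | true  = refl
... | false = refl

upper-+-lower : ∀ {n} (h : Fin n → Fin n → ℤ) → (∀ i → h i i ≡ 0ℤ) →
                ∀ i j → upper h i j + upper (flip h) j i ≡ h i j
upper-+-lower h diag i j with i <? j | j <? i
... | yes i<j | yes j<i = ⊥-elim (FinP.<-asym i<j j<i)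
... | yes _   | no _    = ℤP.+-identityʳ (h i j)
... | no _    | yes _   = ℤP.+-identityˡ (h i j)
... | no i≮j  | no j≮i  with FinP.toℕ-injective (ℕP.≤-antisym (ℕP.≮⇒≥ j≮i) (ℕP.≮⇒≥ i≮j))
...   | refl = ≡.sym (diag i)

∑-upper-symmetrise : ∀ {n} (h : Fin n → Fin n → ℤ) → (∀ i → h i i ≡ 0ℤ) →
                     ∑[ i < n ] ∑[ j < n ] upper (λ i j → h i j + h j i) i j ≡ ∑[ i < n ] ∑[ j < n ] h i j
∑-upper-symmetrise {n} h diag = begin
  ∑[ i < n ] ∑[ j < n ] upper (λ i j → h i j + h j i) i j
    ≡⟨ sum-cong-≗ (λ i → trans (sum-cong-≗ (upper-+ h (flip h) i)) (∑-distrib-+ (U i) (L i))) ⟩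
  ∑[ i < n ] (∑[ j < n ] U i j + ∑[ j < n ] L i j)
    ≡⟨ ∑-distrib-+ (λ i → ∑[ j < n ] U i j) (λ i → ∑[ j < n ] L i j) ⟩
  ∑[ i < n ] ∑[ j < n ] U i j + ∑[ i < n ] ∑[ j < n ] L i j
    ≡⟨ cong (_+_ (∑[ i < n ] ∑[ j < n ] U i j)) (∑-comm L) ⟩
  ∑[ i < n ] ∑[ j < n ] U i j + ∑[ i < n ] ∑[ j < n ] L j i
    ≡⟨ ≡.sym (∑-distrib-+ (λ i → ∑[ j < n ] U i j) (λ i → ∑[ j < n ] L j i)) ⟩
  ∑[ i < n ] (∑[ j < n ] U i j + ∑[ j < n ] L j i)
    ≡⟨ sum-cong-≗ (λ i → trans (≡.sym (∑-distrib-+ (U i) (λ j → L j i)))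
                               (sum-cong-≗ (upper-+-lower h diag i))) ⟩
  ∑[ i < n ] ∑[ j < n ] h i j ∎
  where
  open ≡-Reasoning
  U L : Fin n → Fin n → ℤ
  U = upper h
  L = upper (flip h)

maxList-∈ : ∀ {y} {ys : List ℤ} → y ∈ₗ ys → maxList ys ∈ₗ ys
maxList-∈ {ys = x ∷ xs} _ = go x xs
  where
  go : ∀ x xs → maxList (x ∷ xs) ∈ₗ x ∷ xs
  go x []       = here refl
  go x (y ∷ ys) with ℤP.⊔-sel x (maxList (y ∷ ys))
  ... | inj₁ eq rewrite eq = here refl
  ... | inj₂ eq rewrite eq = there (go y ys)

minList-≤ : ∀ {y} {ys : List ℤ} → y ∈ₗ ys → minList ys ≤ y
minList-≤ {ys = x ∷ []}     (here refl) = ℤP.≤-refl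
minList-≤ {ys = x ∷ y ∷ ys} (here refl) = ℤP.i⊓j≤i x _
minList-≤ {ys = x ∷ y ∷ ys} (there y∈) = ℤP.≤-trans (ℤP.i⊓j≤j x _) (minList-≤ y∈)

All-anti-mono : ∀ {A : Set} {P : A → Set} {k m} {xs : Vec A k} {ys : Vec A m} →
                (∀ {u} → u ∈ ys → u ∈ xs) → All P xs → All P ys
All-anti-mono {ys = []}     ys⊆xs all = []
All-anti-mono {ys = y ∷ ys} ys⊆xs all =
  All.lookup all (ys⊆xs (here refl)) ∷ All-anti-mono (ys⊆xs ∘ there) all

-- Definitionally equal to the pattern lambda in select's recursive case, so ∈-map⁻ applies there.
prependToRest : ∀ {A : Set} {k} → A → A × Vec A k → A × Vec A (suc k)
prependToRest x (y , ys) = y , x ∷ ys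

module _ {A : Set} where

  select-head : ∀ {k} (x : A) (xs : Vec A k) → (x , xs) ∈ₗ select (x ∷ xs)
  select-head x []      = here refl
  select-head x (_ ∷ _) = here refl

  select-∈ : ∀ {k} {xs : Vec A (suc k)} {v r} → (v , r) ∈ₗ select xs → v ∈ xs
  select-∈ {zero}  {x ∷ []} (here refl) = here refl
  select-∈ {suc k} {x ∷ xs} (here refl) = here refl
  select-∈ {suc k} {x ∷ xs} (there p) with ∈-map⁻ (prependToRest x) p
  ... | _ , q , refl = there (select-∈ q)

  select-⊆ : ∀ {k} {xs : Vec A (suc k)} {v r} → (v , r) ∈ₗ select xs → ∀ {u} → u ∈ r → u ∈ xs
  select-⊆ {suc k} {x ∷ xs} (here refl) u∈r = there u∈r
  select-⊆ {suc k} {x ∷ xs} (there p) u∈r with ∈-map⁻ (prependToRest x) p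
  select-⊆ {suc k} {x ∷ xs} (there p) (here u≡x) | _ , q , refl = here u≡x
  select-⊆ {suc k} {x ∷ xs} (there p) (there u∈) | _ , q , refl = there (select-⊆ q u∈)

  select-∈-rest : ∀ {k} {xs : Vec A (suc k)} {v r} → (v , r) ∈ₗ select xs →
                  ∀ {u} → u ∈ xs → u ≢ v → u ∈ r
  select-∈-rest {zero}  {x ∷ []} (here refl) (here u≡x) u≢x = ⊥-elim (u≢x u≡x)
  select-∈-rest {suc k} {x ∷ xs} (here refl) (here u≡x) u≢x = ⊥-elim (u≢x u≡x)
  select-∈-rest {suc k} {x ∷ xs} (here refl) (there u∈) _   = u∈
  select-∈-rest {suc k} {x ∷ xs} (there p) u∈ u≢v with ∈-map⁻ (prependToRest x) p
  select-∈-rest {suc k} {x ∷ xs} (there p) (here u≡x) u≢v | _ , q , refl = here u≡x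
  select-∈-rest {suc k} {x ∷ xs} (there p) (there u∈) u≢v | _ , q , refl =
    there (select-∈-rest q u∈ u≢v)

  select-unique : ∀ {k} {xs : Vec A (suc k)} {v r} → (v , r) ∈ₗ select xs → Unique xs → Unique (v ∷ r)
  select-unique {zero}  {x ∷ []} (here refl) xs! = xs!
  select-unique {suc k} {x ∷ xs} (here refl) xs! = xs!
  select-unique {suc k} {x ∷ xs} (there p) (x∉xs ∷ xs!) with ∈-map⁻ (prependToRest x) p
  ... | _ , q , refl with select-unique q xs!
  ...   | y∉ys ∷ ys! = ((λ y≡x → All.lookup x∉xs (select-∈ q) (≡.sym y≡x)) ∷ y∉ys)
                     ∷ (All-anti-mono (select-⊆ q) x∉xs ∷ ys!)

σ : Owner → ℤ
σ unclaimed     = 0ℤ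
σ (owned Left)  = 1ℤ
σ (owned Right) = -1ℤ

module _ {n : ℕ} (G : SimpleGraph n) where

  degree-∑ : ∀ u → + degree G u ≡ ∑[ v < n ] indicator (adj G u v)
  degree-∑ u = trans (count-tabulate (λ v → adj G u v Data.Bool.≟ true) id)
                     (sum-cong-≗ (λ v → cong indicator (does-≟-true (adj G u v))))
    where
    does-≟-true : ∀ b → does (b Data.Bool.≟ true) ≡ b
    does-≟-true true  = refl
    does-≟-true false = refl

  potential : State n → ℤ
  potential s = ∑[ u < n ] (σ (s u) * + degree G u)

  score-∑ : ∀ s → score G s ≡ ∑[ u < n ] ∑[ v < n ] upper (edgeVal G s) u v
  score-∑ s = trans (foldr-tabulate _ (λ u → ∑[ v < n ] upper (edgeVal G s) u v) inner id 0ℤ)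
                    (ℤP.+-identityʳ _)
    where
    inner : ∀ u a → Vec.foldr _ _ a (allFin n) ≡ ∑[ v < n ] upper (edgeVal G s) u v + a
    inner u a = foldr-tabulate _ (upper (edgeVal G s) u) (λ _ _ → refl) id a

  twice-edgeVal : ∀ s u v → s u ≢ unclaimed → s v ≢ unclaimed →
                  + 2 * edgeVal G s u v ≡ σ (s u) * indicator (adj G u v) + σ (s v) * indicator (adj G u v)
  twice-edgeVal s u v su sv with adj G u v | s u | s v
  ... | _     | unclaimed   | _           = ⊥-elim (su refl)
  ... | _     | _           | unclaimed   = ⊥-elim (sv refl)
  ... | false | owned p     | owned q     = ≡.sym (cong₂ _+_ (ℤP.*-zeroʳ (σ (owned p))) (ℤP.*-zeroʳ (σ (owned q))))
  ... | true  | owned Left  | owned Left  = refl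
  ... | true  | owned Left  | owned Right = refl
  ... | true  | owned Right | owned Left  = refl
  ... | true  | owned Right | owned Right = refl

  twice-score : ∀ s → (∀ u → s u ≢ unclaimed) → + 2 * score G s ≡ potential s
  twice-score s full = begin
    + 2 * score G s
      ≡⟨ cong (+ 2 *_) (score-∑ s) ⟩
    + 2 * ∑[ u < n ] ∑[ v < n ] upper (edgeVal G s) u v
      ≡⟨ trans (*-distribˡ-sum (+ 2) (λ u → ∑[ v < n ] upper (edgeVal G s) u v))
               (sum-cong-≗ (λ u → *-distribˡ-sum (+ 2) (upper (edgeVal G s) u))) ⟩
    ∑[ u < n ] ∑[ v < n ] (+ 2 * upper (edgeVal G s) u v)
      ≡⟨ sum-cong-≗ (λ u → sum-cong-≗ (twice-upper u)) ⟩
    ∑[ u < n ] ∑[ v < n ] upper (λ u v → h u v + h v u) u v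
      ≡⟨ ∑-upper-symmetrise h h-diag ⟩
    ∑[ u < n ] ∑[ v < n ] h u v
      ≡⟨ sum-cong-≗ (λ u → trans (≡.sym (*-distribˡ-sum (σ (s u)) (λ v → indicator (adj G u v))))
                                 (cong (σ (s u) *_) (≡.sym (degree-∑ u)))) ⟩
    potential s ∎
    where
    open ≡-Reasoning
    h : Fin n → Fin n → ℤ
    h u v = σ (s u) * indicator (adj G u v)
    h-diag : ∀ u → h u u ≡ 0ℤ
    h-diag u = trans (cong (λ b → σ (s u) * indicator b) (irrefl G u)) (ℤP.*-zeroʳ (σ (s u)))
    twice-upper : ∀ u v → + 2 * upper (edgeVal G s) u v ≡ upper (λ u v → h u v + h v u) u v
    twice-upper u v with ⌊ u <? v ⌋
    ... | false = refl
    ... | true  = trans (twice-edgeVal s u v (full u) (full v))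
                        (cong (λ b → h u v + σ (s v) * indicator b) (SimpleGraph.sym G u v))

  claim-≡ : ∀ v p (s : State n) → claim v p s v ≡ owned p
  claim-≡ v p s with v FinP.≟ v
  ... | yes _   = refl
  ... | no v≢v = ⊥-elim (v≢v refl)

  claim-≢ : ∀ {u v} p (s : State n) → u ≢ v → claim v p s u ≡ s u
  claim-≢ {u} {v} p s u≢v with u FinP.≟ v
  ... | yes u≡v = ⊥-elim (u≢v u≡v)
  ... | no _    = refl

  potential-claim : ∀ v p s → s v ≡ unclaimed →
                    potential (claim v p s) ≡ potential s + σ (owned p) * + degree G v
  potential-claim v p s sv = begin
    potential (claim v p s)
      ≡⟨ ≡.sym (ℤP.+-identityˡ _) ⟩
    0ℤ + potential (claim v p s)
      ≡⟨ cong (λ o → σ o * + degree G v + potential (claim v p s)) (≡.sym sv) ⟩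
    term s v + potential (claim v p s)
      ≡⟨ ∑-update (term s) (term (claim v p s)) v unchanged ⟩
    term (claim v p s) v + potential s
      ≡⟨ cong (λ o → σ o * + degree G v + potential s) (claim-≡ v p s) ⟩
    σ (owned p) * + degree G v + potential s
      ≡⟨ ℤP.+-comm (σ (owned p) * + degree G v) (potential s) ⟩
    potential s + σ (owned p) * + degree G v ∎
    where
    open ≡-Reasoning
    term : State n → Fin n → ℤ
    term s u = σ (s u) * + degree G u
    unchanged : ∀ u → u ≢ v → term s u ≡ term (claim v p s) u
    unchanged u u≢v = cong (λ o → σ o * + degree G u) (≡.sym (claim-≢ p s u≢v))

  potential-unclaimed : potential (λ _ → unclaimed) ≡ 0ℤ
  potential-unclaimed = sum-replicate-zero n

  maxDegreeOf : ∀ {k} → Vec (Fin n) k → ℕ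
  maxDegreeOf = Vec.foldr _ (λ v m → degree G v ℕ.⊔ m) 0

  degree≤maxDegreeOf : ∀ {k} {xs : Vec (Fin n) k} {u} → u ∈ xs → degree G u ℕ.≤ maxDegreeOf xs
  degree≤maxDegreeOf {xs = x ∷ xs} (here refl) = ℕP.m≤m⊔n (degree G x) (maxDegreeOf xs)
  degree≤maxDegreeOf {xs = x ∷ xs} (there u∈) =
    ℕP.≤-trans (degree≤maxDegreeOf u∈) (ℕP.m≤n⊔m (degree G x) (maxDegreeOf xs))

  maxDegreeOf-mono : ∀ {k m} {xs : Vec (Fin n) k} {ys : Vec (Fin n) m} →
                     (∀ {u} → u ∈ ys → u ∈ xs) → maxDegreeOf ys ℕ.≤ maxDegreeOf xs
  maxDegreeOf-mono {ys = []}     ys⊆xs = ℕ.z≤n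
  maxDegreeOf-mono {ys = y ∷ ys} ys⊆xs =
    ℕP.⊔-lub (degree≤maxDegreeOf (ys⊆xs (here refl))) (maxDegreeOf-mono (ys⊆xs ∘ there))

  select-maxDegree : ∀ {k} (xs : Vec (Fin n) (suc k)) →
                     ∃₂ λ v r → (v , r) ∈ₗ select xs × maxDegreeOf xs ℕ.≤ degree G v
  select-maxDegree (x ∷ []) = x , [] , here refl , ℕP.⊔-lub ℕP.≤-refl ℕ.z≤n
  select-maxDegree (x ∷ xs@(_ ∷ _)) with select-maxDegree xs
  ... | y , ys , p , xs≤y with ℕP.≤-total (degree G y) (degree G x)
  ...   | inj₁ y≤x = x , xs , here refl , ℕP.⊔-lub ℕP.≤-refl (ℕP.≤-trans xs≤y y≤x)
  ...   | inj₂ x≤y = y , x ∷ ys , there (∈-map⁺ (prependToRest x) p) , ℕP.⊔-lub x≤y xs≤y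

  record Remaining {k} (s : State n) (rest : Vec (Fin n) k) : Set where
    field
      unique      : Unique rest
      unclaimed⇒∈ : ∀ {u} → s u ≡ unclaimed → u ∈ rest
      ∈⇒unclaimed : ∀ {u} → u ∈ rest → s u ≡ unclaimed

  remaining-initial : Remaining (λ _ → unclaimed) (allFin n)
  remaining-initial = record
    { unique      = Unique.tabulate⁺ id
    ; unclaimed⇒∈ = λ {u} _ → ∈-allFin⁺ u
    ; ∈⇒unclaimed = λ _ → refl
    }

  remaining-claim : ∀ {k s} {rest : Vec (Fin n) (suc k)} {v r} p →
                    Remaining s rest → (v , r) ∈ₗ select rest → Remaining (claim v p s) r
  remaining-claim {s = s} {v = v} {r} p R v,r∈ = record
    { unique      = AllPairs.tail v∷r!
    ; unclaimed⇒∈ = λ {u} e → select-∈-rest v,r∈ (unclaimed⇒∈ (was-unclaimed u e)) (≢v u e)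
    ; ∈⇒unclaimed = λ {u} u∈r →
        trans (claim-≢ p s (λ { refl → v∉r u∈r })) (∈⇒unclaimed (select-⊆ v,r∈ u∈r))
    }
    where
    open Remaining R
    v∷r! : Unique (v ∷ r)
    v∷r! = select-unique v,r∈ unique
    v∉r : ¬ v ∈ r
    v∉r v∈r = All.lookup (AllPairs.head v∷r!) v∈r refl
    ≢v : ∀ u → claim v p s u ≡ unclaimed → u ≢ v
    ≢v u e refl with () ← trans (≡.sym (claim-≡ v p s)) e
    was-unclaimed : ∀ u → claim v p s u ≡ unclaimed → s u ≡ unclaimed
    was-unclaimed u e = trans (≡.sym (claim-≢ p s (≢v u e))) e

  remaining-[]-full : ∀ {s} → Remaining s [] → ∀ u → s u ≢ unclaimed
  remaining-[]-full R u e with () ← Remaining.unclaimed⇒∈ R e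

  afterMove : ∀ {k} → Player → State n → Fin n × Vec (Fin n) k → ℤ
  afterMove {k} p s (v , r) = play G k r (other p) (claim v p s)

  open ℤP.≤-Reasoning

  mutual
    twice-play-Left≤ : ∀ {k} {rest : Vec (Fin n) k} {s} → Remaining s rest →
                       + 2 * play G k rest Left s ≤ potential s + + maxDegreeOf rest
    twice-play-Left≤ {zero} {[]} {s} R =
      ℤP.≤-reflexive (trans (twice-score s (remaining-[]-full R)) (≡.sym (ℤP.+-identityʳ _)))
    twice-play-Left≤ {suc k} {x ∷ xs} {s} R
      with ∈-map⁻ (afterMove Left s) (maxList-∈ (∈-map⁺ (afterMove Left s) (select-head x xs)))
    ... | (v , r) , v,r∈ , best = begin
      + 2 * maxList (List.map (afterMove Left s) (select (x ∷ xs)))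
        ≡⟨ cong (+ 2 *_) best ⟩
      + 2 * play G k r Right (claim v Left s)
        ≤⟨ twice-play-Right≤ (remaining-claim Left R v,r∈) ⟩
      potential (claim v Left s)
        ≡⟨ potential-claim v Left s (∈⇒unclaimed (select-∈ v,r∈)) ⟩
      potential s + 1ℤ * + degree G v
        ≡⟨ cong (_+_ (potential s)) (ℤP.*-identityˡ _) ⟩
      potential s + + degree G v
        ≤⟨ ℤP.+-monoʳ-≤ (potential s) (+≤+ (degree≤maxDegreeOf (select-∈ v,r∈))) ⟩
      potential s + + maxDegreeOf (x ∷ xs) ∎
      where open Remaining R

    twice-play-Right≤ : ∀ {k} {rest : Vec (Fin n) k} {s} → Remaining s rest →
                        + 2 * play G k rest Right s ≤ potential s
    twice-play-Right≤ {zero} {[]} {s} R = ℤP.≤-reflexive (twice-score s (remaining-[]-full R))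
    twice-play-Right≤ {suc k} {rest} {s} R with select-maxDegree rest
    ... | v , r , v,r∈ , rest≤v = begin
      + 2 * minList (List.map (afterMove Right s) (select rest))
        ≤⟨ ℤP.*-monoˡ-≤-nonNeg (+ 2) (minList-≤ (∈-map⁺ (afterMove Right s) v,r∈)) ⟩
      + 2 * play G k r Left (claim v Right s)
        ≤⟨ twice-play-Left≤ (remaining-claim Right R v,r∈) ⟩
      potential (claim v Right s) + + maxDegreeOf r
        ≡⟨ cong (_+ + maxDegreeOf r) (potential-claim v Right s (∈⇒unclaimed (select-∈ v,r∈))) ⟩
      potential s + -1ℤ * + degree G v + + maxDegreeOf r
        ≤⟨ ℤP.+-monoʳ-≤ (potential s + -1ℤ * + degree G v) (+≤+ r≤v) ⟩
      potential s + -1ℤ * + degree G v + + degree G v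
        ≡⟨ cancel (potential s) (+ degree G v) ⟩
      potential s ∎
      where
      open Remaining R
      r≤v : maxDegreeOf r ℕ.≤ degree G v
      r≤v = ℕP.≤-trans (maxDegreeOf-mono (select-⊆ v,r∈)) rest≤v
      cancel : ∀ a d → a + -1ℤ * d + d ≡ a
      cancel = solve-∀

mainTheorem15 : ∀ (n : ℕ) (G : SimpleGraph n) → + 2 * Ls G ≤ + maxDegree G
mainTheorem15 n G = begin
  + 2 * Ls G                                     ≤⟨ twice-play-Left≤ G (remaining-initial G) ⟩
  potential G (λ _ → unclaimed) + + maxDegree G  ≡⟨ cong (_+ + maxDegree G) (potential-unclaimed G) ⟩
  0ℤ + + maxDegree G                             ≡⟨ ℤP.+-identityˡ _ ⟩
  + maxDegree G                                  ∎
  where open ℤP.≤-Reasoning
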